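{- Let $F=(F_1,\ldots,F_n)\in\mathbb{Z}[X_1,\ldots,X_n]^n$ be a polynomial map of the form $F_i=X_i+H_i$, where each $H_i$ has lower degree $\ge 2$, and let $D=\max_i\deg H_i$. Let $P_0(X)=X$, $P_{k+1}=P_k\circ F-P_k$. Let $B$ be the maximum of the absolute values of the coefficients of monomials appearing in $F$, and let $B_k$ be the maximum of the absolute values of the coefficients of monomials appearing in the components of $P_k$. For $k\ge1$ put $l_k=\big(l(F)-1\big)\prod_{j=1}^{k-1}\big[l(F)^{D^j}+1\big]$. Then for every $k=1,2,\ldots$ we have \[ B_{k+1}\le B_k\cdot B^{D^k}\cdot l_{k+1}.\]
   Context: The lower degree of a polynomial is the minimal total degree of a monomial appearing in it with nonzero coefficient. For a polynomial $T$, its length $l(T)$ is the number of monomials appearing in $T$ (with nonzero coefficient); for a polynomial map $T=(T_1,\ldots,T_n)$, $l(T)=\max\{l(T_1),\ldots,l(T_n)\}$. -}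

module Defs where

open import Data.Nat as ℕ using (ℕ; zero; suc; _⊔_; _⊓_; _≤_; _^_)
open import Data.Integer as ℤ using (ℤ; ∣_∣)
open import Data.Fin as Fin using (Fin)
open import Data.Bool using (if_then_else_)
open import Data.Product using (_×_; _,_; proj₁; proj₂)
open import Data.List as List using (List; []; _∷_; _++_; concatMap; filter; deduplicate)
open import Data.Vec as Vec using (Vec; tabulate; zipWith; replicate)
import Data.Vec.Properties as VecP
open import Data.List.Relation.Unary.All using (All)
open import Relation.Nullary using (¬?; does)
open import Relation.Binary.PropositionalEquality using (_≡_)

-- Polynomials in n variables over ℤ, represented as finite formal sums of
-- terms c·X^α (a list of (coefficient, exponent vector)).  The actual
-- coefficient of a monomial is the sum of the coefficients of all terms
-- with that exponent (see `coeff`); all notions below are defined through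
-- these actual coefficients, so they do not depend on the representation.

Mono : ℕ → Set
Mono n = Vec ℕ n

Poly : ℕ → Set
Poly n = List (ℤ × Mono n)

PolyMap : ℕ → ℕ → Set
PolyMap m n = Vec (Poly n) m

module _ {n : ℕ} where

  monoEq : (α β : Mono n) → Relation.Nullary.Dec (α ≡ β)
  monoEq = VecP.≡-dec ℕ._≟_

  coeff : Poly n → Mono n → ℤ
  coeff [] α = ℤ.0ℤ
  coeff ((c , β) ∷ p) α = if does (monoEq β α) then c ℤ.+ coeff p α else coeff p α

  support : Poly n → List (Mono n)
  support p = filter (λ α → ¬? (coeff p α ℤ.≟ ℤ.0ℤ))
                     (deduplicate monoEq (List.map proj₂ p))

  totalDeg : Mono n → ℕ
  totalDeg α = Vec.sum α

  maxℕ : List ℕ → ℕ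
  maxℕ = List.foldr _⊔_ 0

  len : Poly n → ℕ
  len p = List.length (support p)

  -- total degree (0 for the zero polynomial)
  deg : Poly n → ℕ
  deg p = maxℕ (List.map totalDeg (support p))

  LowerDeg≥ : ℕ → Poly n → Set
  LowerDeg≥ d p = All (λ α → d ≤ totalDeg α) (support p)

  maxCoeff : Poly n → ℕ
  maxCoeff p = maxℕ (List.map (λ α → ∣ coeff p α ∣) (support p))

  constP : ℤ → Poly n
  constP c = (c , replicate n 0) ∷ []

  varP : Fin n → Poly n
  varP i = (ℤ.1ℤ , tabulate (λ j → if does (i Fin.≟ j) then 1 else 0)) ∷ []

  _+P_ : Poly n → Poly n → Poly n
  p +P q = p ++ q

  negP : Poly n → Poly n
  negP = List.map (λ t → ℤ.- proj₁ t , proj₂ t)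

  _-P_ : Poly n → Poly n → Poly n
  p -P q = p +P negP q

  _*P_ : Poly n → Poly n → Poly n
  p *P q = concatMap (λ t → List.map (λ s → proj₁ t ℤ.* proj₁ s , zipWith ℕ._+_ (proj₂ t) (proj₂ s)) q) p

  _^P_ : Poly n → ℕ → Poly n
  p ^P zero = constP ℤ.1ℤ
  p ^P suc k = p *P (p ^P k)

compose : {m n : ℕ} → Poly m → PolyMap m n → Poly n
compose [] G = []
compose ((c , α) ∷ p) G =
  (constP c *P Vec.foldr _ _*P_ (constP ℤ.1ℤ) (zipWith _^P_ G α)) +P compose p G

composeMap : {k m n : ℕ} → PolyMap k m → PolyMap m n → PolyMap k n
composeMap P G = Vec.map (λ p → compose p G) P

idMap : (n : ℕ) → PolyMap n n
idMap n = tabulate varP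

lenMap : {m n : ℕ} → PolyMap m n → ℕ
lenMap T = Vec.foldr _ _⊔_ 0 (Vec.map len T)

maxCoeffMap : {m n : ℕ} → PolyMap m n → ℕ
maxCoeffMap T = Vec.foldr _ _⊔_ 0 (Vec.map maxCoeff T)

degMap : {m n : ℕ} → PolyMap m n → ℕ
degMap T = Vec.foldr _ _⊔_ 0 (Vec.map deg T)

plusX : {n : ℕ} → PolyMap n n → PolyMap n n
plusX {n} H = zipWith _+P_ (idMap n) H

Pseq : {n : ℕ} → PolyMap n n → ℕ → PolyMap n n
Pseq {n} F zero = idMap n
Pseq F (suc k) = zipWith _-P_ (composeMap (Pseq F k) F) (Pseq F k)

-- ∏_{j=a}^{b} f j  (a ≤ j ≤ b; empty product = 1)
prodFromTo : ℕ → ℕ → (ℕ → ℕ) → ℕ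
prodFromTo a b f = List.foldr ℕ._*_ 1 (List.map f (List.map (a ℕ.+_) (List.upTo (suc b ℕ.∸ a))))

lseq : (lF D : ℕ) → ℕ → ℕ
lseq lF D k = (lF ℕ.∸ 1) ℕ.* prodFromTo 1 (k ℕ.∸ 1) (λ j → lF ^ (D ^ j) ℕ.+ 1)

module Submission where

-- The argument runs on two levels.
--   * Coefficient level: ring operations and composition respect ≈P, so
--     P_{k+1} ≈ Q_k := N(P_k) ∘ N(F) − N(P_k), where N p lists each monomial
--     of p exactly once with its true coefficient (the normal form).
--   * Term level: for a multiplicative weight w on ℤ, the weighted mass
--     μ p = Σ w(c) over the terms of a list is multiplicative, hence
--     μ (p ∘ G) ≤ μ p · M^E when the terms of p have degree ≤ E and μ G_j ≤ M.
--     With w = |·| the mass bounds every coefficient; with w = 1 it counts terms.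
-- For F = X + H with lower degree of H ≥ 2 we get l(F) ≥ 1 and B ≥ 1 and,
-- by induction, deg P_k ≤ D^k and l(P_k) ≤ l_k for k ≥ 1.  Then the mass of
-- Q_k is at most l_k B_k (l B)^{D^k} + l_k B_k ≤ B_k B^{D^k} l_{k+1}.

open import Defs
open import Data.Nat as ℕ using (ℕ; zero; suc; _≤_; _⊔_; _+_; _*_; _^_; _∸_; z≤n; s≤s)
import Data.Nat.Properties as NP
open import Data.Integer as ℤ using (ℤ; ∣_∣; 0ℤ; 1ℤ)
  renaming (_+_ to _+ᶻ_; _*_ to _*ᶻ_; -_ to -ᶻ_)
import Data.Integer.Properties as ZP
import Data.Nat.Tactic.RingSolver as ℕ-Solver
import Data.Integer.Tactic.RingSolver as ℤ-Solver
open import Data.Fin as Fin using (Fin)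
open import Data.Vec as Vec using (Vec; lookup; tabulate)
open import Data.Vec.Properties using (lookup-zipWith; lookup-map; lookup∘tabulate)
open import Data.List as List using (List; []; _∷_; _++_; length)
open import Data.List.Properties using (length-++-sucʳ; length-map; map-++; upTo-∷ʳ)
open import Data.Nat.ListAction using (product)
open import Data.Nat.ListAction.Properties using (product-++)
open import Data.List.Relation.Unary.All as All using (All; []; _∷_)
import Data.List.Relation.Unary.All.Properties as AllP
open import Data.List.Relation.Unary.Any using (here; there)
import Data.List.Relation.Unary.AllPairs as AllPairs
open import Data.List.Relation.Unary.Unique.Propositional using (Unique)
import Data.List.Relation.Unary.Unique.Propositional.Properties as UniqueP
import Data.List.Relation.Unary.Unique.DecPropositional.Properties as UniqueDecP
open import Data.List.Membership.Propositional using (_∈_)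
open import Data.List.Membership.Propositional.Properties
  using (∈-∃++; ∈-++⁻; ∈-++⁺ˡ; ∈-++⁺ʳ; ∈-filter⁻; ∈-filter⁺; ∈-deduplicate⁺)
open import Data.List.Membership.DecPropositional using (_∈?_)
open import Data.Product using (_,_; proj₁; proj₂)
open import Data.Sum using (inj₁; inj₂)
open import Data.Bool using (if_then_else_; true; false)
open import Data.Empty using (⊥-elim)
open import Relation.Nullary using (yes; no; does; ¬_; ¬?)
open import Relation.Binary.PropositionalEquality

-- Coefficient calculus.  `lin g p` is the linear extension of a function g on
-- monomials, evaluated on the terms of p; the key fact `lin-cong` says it only
-- depends on the coefficients of p.  Every coefficient of a product or a
-- composite is such a linear expression, which gives the congruence lemmas.

module _ {n : ℕ} where

  -- Two term lists are equivalent when they define the same polynomial.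
  -- (A record, so that the two lists can be inferred from an equivalence.)
  record _≈P_ (p q : Poly n) : Set where
    constructor coeffwise
    field same-coeff : ∀ γ → coeff p γ ≡ coeff q γ
  open _≈P_ public

  ≈-sym : ∀ {p q : Poly n} → p ≈P q → q ≈P p
  ≈-sym p≈q = coeffwise λ γ → sym (same-coeff p≈q γ)

  ≈-trans : ∀ {p q r : Poly n} → p ≈P q → q ≈P r → p ≈P r
  ≈-trans p≈q q≈r = coeffwise λ γ → trans (same-coeff p≈q γ) (same-coeff q≈r γ)

  lin : (Mono n → ℤ) → Poly n → ℤ
  lin g [] = 0ℤ
  lin g ((c , β) ∷ p) = c *ᶻ g β +ᶻ lin g p

  lin-ext : ∀ {g h} → (∀ α → g α ≡ h α) → ∀ p → lin g p ≡ lin h p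
  lin-ext g≡h [] = refl
  lin-ext g≡h ((c , β) ∷ p) = cong₂ (λ u v → c *ᶻ u +ᶻ v) (g≡h β) (lin-ext g≡h p)

  coeff-++ : ∀ (p q : Poly n) γ → coeff (p ++ q) γ ≡ coeff p γ +ᶻ coeff q γ
  coeff-++ [] q γ = sym (ZP.+-identityˡ _)
  coeff-++ ((c , β) ∷ p) q γ with does (monoEq β γ)
  ... | true = trans (cong (c +ᶻ_) (coeff-++ p q γ)) (sym (ZP.+-assoc c _ _))
  ... | false = coeff-++ p q γ

  coeff-neg : ∀ (p : Poly n) γ → coeff (negP p) γ ≡ -ᶻ coeff p γ
  coeff-neg [] γ = refl
  coeff-neg ((c , β) ∷ p) γ with does (monoEq β γ)
  ... | true = trans (cong (-ᶻ c +ᶻ_) (coeff-neg p γ)) (sym (ZP.neg-distrib-+ c _))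
  ... | false = coeff-neg p γ

  coeff-sub : ∀ (p q : Poly n) γ → coeff (p -P q) γ ≡ coeff p γ +ᶻ -ᶻ coeff q γ
  coeff-sub p q γ = trans (coeff-++ p (negP q) γ) (cong (coeff p γ +ᶻ_) (coeff-neg q γ))

  sub-cong : ∀ {p p' q q' : Poly n} → p ≈P p' → q ≈P q' → (p -P q) ≈P (p' -P q')
  sub-cong {p} {p'} {q} {q'} p≈p' q≈q' = coeffwise λ γ →
    trans (coeff-sub p q γ)
      (trans (cong₂ (λ u v → u +ᶻ -ᶻ v) (same-coeff p≈p' γ) (same-coeff q≈q' γ))
        (sym (coeff-sub p' q' γ)))

  lin-++ : ∀ g (p q : Poly n) → lin g (p ++ q) ≡ lin g p +ᶻ lin g q
  lin-++ g [] q = sym (ZP.+-identityˡ _)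
  lin-++ g ((c , β) ∷ p) q =
    trans (cong (c *ᶻ g β +ᶻ_) (lin-++ g p q)) (sym (ZP.+-assoc (c *ᶻ g β) (lin g p) (lin g q)))

  lin-neg : ∀ g (p : Poly n) → lin g (negP p) ≡ -ᶻ lin g p
  lin-neg g [] = refl
  lin-neg g ((c , β) ∷ p) = trans (cong (-ᶻ c *ᶻ g β +ᶻ_) (lin-neg g p)) (neg-term c (g β) (lin g p))
    where
    neg-term : ∀ c x s → -ᶻ c *ᶻ x +ᶻ -ᶻ s ≡ -ᶻ (c *ᶻ x +ᶻ s)
    neg-term = ℤ-Solver.solve-∀

  dropMono : Mono n → Poly n → Poly n
  dropMono α [] = []
  dropMono α ((c , β) ∷ r) = if does (monoEq β α) then dropMono α r else (c , β) ∷ dropMono α r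

  lin-split : ∀ g α (r : Poly n) → lin g r ≡ coeff r α *ᶻ g α +ᶻ lin g (dropMono α r)
  lin-split g α [] = refl
  lin-split g α ((c , β) ∷ r) with monoEq β α
  ... | yes refl = trans (cong (c *ᶻ g β +ᶻ_) (lin-split g α r)) (merge c (g β) (coeff r α) _)
    where
    merge : ∀ a b c d → a *ᶻ b +ᶻ (c *ᶻ b +ᶻ d) ≡ (a +ᶻ c) *ᶻ b +ᶻ d
    merge = ℤ-Solver.solve-∀
  ... | no _ = trans (cong (c *ᶻ g β +ᶻ_) (lin-split g α r)) (swap c (g β) (coeff r α) (g α) _)
    where
    swap : ∀ a b c d e → a *ᶻ b +ᶻ (c *ᶻ d +ᶻ e) ≡ c *ᶻ d +ᶻ (a *ᶻ b +ᶻ e)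
    swap = ℤ-Solver.solve-∀

  coeff-drop-≢ : ∀ α γ (r : Poly n) → ¬ γ ≡ α → coeff (dropMono α r) γ ≡ coeff r γ
  coeff-drop-≢ α γ [] _ = refl
  coeff-drop-≢ α γ ((c , β) ∷ r) γ≢α with monoEq β α
  ... | yes refl with monoEq β γ
  ...   | yes refl = ⊥-elim (γ≢α refl)
  ...   | no _ = coeff-drop-≢ α γ r γ≢α
  coeff-drop-≢ α γ ((c , β) ∷ r) γ≢α | no _ with monoEq β γ
  ...   | yes refl = cong (c +ᶻ_) (coeff-drop-≢ α γ r γ≢α)
  ...   | no _ = coeff-drop-≢ α γ r γ≢α

  coeff-drop-≡ : ∀ α (r : Poly n) → coeff (dropMono α r) α ≡ 0ℤ
  coeff-drop-≡ α [] = refl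
  coeff-drop-≡ α ((c , β) ∷ r) with monoEq β α
  ... | yes refl = coeff-drop-≡ α r
  ... | no β≢α with monoEq β α   -- the kept head term is tested again by `coeff`
  ...   | yes β≡α = ⊥-elim (β≢α β≡α)
  ...   | no _ = coeff-drop-≡ α r

  length-drop : ∀ α (r : Poly n) → length (dropMono α r) ≤ length r
  length-drop α [] = z≤n
  length-drop α ((c , β) ∷ r) with does (monoEq β α)
  ... | true = NP.m≤n⇒m≤1+n (length-drop α r)
  ... | false = s≤s (length-drop α r)

  length-drop-head : ∀ α c (r : Poly n) → length (dropMono α ((c , α) ∷ r)) ≤ length r
  length-drop-head α c r with monoEq α α
  ... | yes _ = length-drop α r
  ... | no α≢α = ⊥-elim (α≢α refl)

  lin-null : ∀ g m (r : Poly n) → length r ≤ m → (∀ γ → coeff r γ ≡ 0ℤ) → lin g r ≡ 0ℤ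
  lin-null g m [] _ _ = refl
  lin-null g (suc m) r@((c , α) ∷ r') (s≤s |r'|≤m) r≈0 = begin
    lin g r                                      ≡⟨ lin-split g α r ⟩
    coeff r α *ᶻ g α +ᶻ lin g (dropMono α r)     ≡⟨ cong₂ (λ u v → u *ᶻ g α +ᶻ v) (r≈0 α) rest≡0 ⟩
    0ℤ                                           ∎
    where
    open ≡-Reasoning
    dropped≈0 : ∀ γ → coeff (dropMono α r) γ ≡ 0ℤ
    dropped≈0 γ with monoEq γ α
    ... | yes refl = coeff-drop-≡ α r
    ... | no γ≢α = trans (coeff-drop-≢ α γ r γ≢α) (r≈0 γ)
    rest≡0 : lin g (dropMono α r) ≡ 0ℤ
    rest≡0 = lin-null g m (dropMono α r) (NP.≤-trans (length-drop-head α c r') |r'|≤m) dropped≈0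

  lin-cong : ∀ g {p q : Poly n} → p ≈P q → lin g p ≡ lin g q
  lin-cong g {p} {q} p≈q = ZP.i-j≡0⇒i≡j (lin g p) (lin g q) (begin
    lin g p +ᶻ -ᶻ lin g q                 ≡⟨ cong (lin g p +ᶻ_) (lin-neg g q) ⟨
    lin g p +ᶻ lin g (negP q)             ≡⟨ lin-++ g p (negP q) ⟨
    lin g (p -P q)                        ≡⟨ lin-null g _ (p -P q) NP.≤-refl difference≈0 ⟩
    0ℤ                                    ∎)
    where
    open ≡-Reasoning
    difference≈0 : ∀ γ → coeff (p -P q) γ ≡ 0ℤ
    difference≈0 γ = trans (coeff-sub p q γ) (ZP.i≡j⇒i-j≡0 (same-coeff p≈q γ))

  shift : Mono n → Poly n → Poly n
  shift α = List.map (λ s → proj₁ s , Vec.zipWith _+_ α (proj₂ s))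

  δ : Mono n → Mono n → ℤ
  δ γ β = if does (monoEq β γ) then 1ℤ else 0ℤ

  coeff-shift : ∀ α (q : Poly n) γ → coeff (shift α q) γ ≡ lin (λ β → δ γ (Vec.zipWith _+_ α β)) q
  coeff-shift α [] γ = refl
  coeff-shift α ((c , β) ∷ q) γ with does (monoEq (Vec.zipWith _+_ α β) γ)
  ... | true = cong₂ _+ᶻ_ (sym (ZP.*-identityʳ c)) (coeff-shift α q γ)
  ... | false = trans (coeff-shift α q γ)
                  (trans (sym (ZP.+-identityˡ _))
                    (cong (_+ᶻ lin (λ β → δ γ (Vec.zipWith _+_ α β)) q) (sym (ZP.*-zeroʳ c))))

  shift-cong : ∀ α {q q' : Poly n} → q ≈P q' → shift α q ≈P shift α q'
  shift-cong α {q} {q'} q≈q' = coeffwise λ γ →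
    trans (coeff-shift α q γ) (trans (lin-cong _ q≈q') (sym (coeff-shift α q' γ)))

  coeff-scale : ∀ c (f : Mono n → Mono n) (q : Poly n) γ →
    coeff (List.map (λ s → c *ᶻ proj₁ s , f (proj₂ s)) q) γ
      ≡ c *ᶻ coeff (List.map (λ s → proj₁ s , f (proj₂ s)) q) γ
  coeff-scale c f [] γ = sym (ZP.*-zeroʳ c)
  coeff-scale c f ((d , β) ∷ q) γ with does (monoEq (f β) γ)
  ... | true = trans (cong (c *ᶻ d +ᶻ_) (coeff-scale c f q γ)) (sym (ZP.*-distribˡ-+ c d _))
  ... | false = coeff-scale c f q γ

  coeff-* : ∀ (p q : Poly n) γ → coeff (p *P q) γ ≡ lin (λ α → coeff (shift α q) γ) p
  coeff-* [] q γ = refl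
  coeff-* ((c , α) ∷ p) q γ =
    trans (coeff-++ (List.map (λ s → c *ᶻ proj₁ s , Vec.zipWith _+_ α (proj₂ s)) q) (p *P q) γ)
      (cong₂ _+ᶻ_ (coeff-scale c (Vec.zipWith _+_ α) q γ) (coeff-* p q γ))

  *-cong : ∀ {p p' q q' : Poly n} → p ≈P p' → q ≈P q' → (p *P q) ≈P (p' *P q')
  *-cong {p} {p'} {q} {q'} p≈p' q≈q' = coeffwise λ γ → begin
    coeff (p *P q) γ                         ≡⟨ coeff-* p q γ ⟩
    lin (λ α → coeff (shift α q) γ) p        ≡⟨ lin-ext (λ α → same-coeff (shift-cong α q≈q') γ) p ⟩
    lin (λ α → coeff (shift α q') γ) p       ≡⟨ lin-cong _ p≈p' ⟩
    lin (λ α → coeff (shift α q') γ) p'      ≡⟨ coeff-* p' q' γ ⟨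
    coeff (p' *P q') γ                       ∎
    where open ≡-Reasoning

  ^-cong : ∀ {p p' : Poly n} → p ≈P p' → ∀ k → (p ^P k) ≈P (p' ^P k)
  ^-cong p≈p' zero = coeffwise λ γ → refl
  ^-cong p≈p' (suc k) = *-cong p≈p' (^-cong p≈p' k)

monoAt : ∀ {m n} → PolyMap m n → Mono m → Poly n
monoAt G α = Vec.foldr _ _*P_ (constP 1ℤ) (Vec.zipWith _^P_ G α)

monoAt-cong : ∀ {m n} (G G' : PolyMap m n) α → (∀ j → lookup G j ≈P lookup G' j) →
  monoAt G α ≈P monoAt G' α
monoAt-cong Vec.[] Vec.[] Vec.[] G≈G' = coeffwise λ γ → refl
monoAt-cong (g Vec.∷ G) (g' Vec.∷ G') (a Vec.∷ α) G≈G' =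
  *-cong (^-cong (G≈G' Fin.zero) a) (monoAt-cong G G' α (λ j → G≈G' (Fin.suc j)))

zipWith-+-identityˡ : ∀ {m} (β : Vec ℕ m) → Vec.zipWith _+_ (Vec.replicate m 0) β ≡ β
zipWith-+-identityˡ Vec.[] = refl
zipWith-+-identityˡ (b Vec.∷ β) = cong (b Vec.∷_) (zipWith-+-identityˡ β)

zipWith-+-identityʳ : ∀ {m} (β : Vec ℕ m) → Vec.zipWith _+_ β (Vec.replicate m 0) ≡ β
zipWith-+-identityʳ Vec.[] = refl
zipWith-+-identityʳ (b Vec.∷ β) = cong₂ Vec._∷_ (NP.+-identityʳ b) (zipWith-+-identityʳ β)

shift-zero : ∀ {n} (q : Poly n) → shift (Vec.replicate n 0) q ≡ q
shift-zero [] = refl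
shift-zero ((c , β) ∷ q) = cong₂ _∷_ (cong (c ,_) (zipWith-+-identityˡ β)) (shift-zero q)

coeff-const* : ∀ {n} c (q : Poly n) γ → coeff (constP c *P q) γ ≡ c *ᶻ coeff q γ
coeff-const* c q γ =
  trans (coeff-* (constP c) q γ) (trans (ZP.+-identityʳ _) (cong (λ u → c *ᶻ coeff u γ) (shift-zero q)))

coeff-compose : ∀ {m n} (p : Poly m) (G : PolyMap m n) γ →
  coeff (compose p G) γ ≡ lin (λ α → coeff (monoAt G α) γ) p
coeff-compose [] G γ = refl
coeff-compose ((c , α) ∷ p) G γ =
  trans (coeff-++ (constP c *P monoAt G α) (compose p G) γ)
    (cong₂ _+ᶻ_ (coeff-const* c (monoAt G α) γ) (coeff-compose p G γ))

compose-cong : ∀ {m n} {p p' : Poly m} {G G' : PolyMap m n} → p ≈P p' →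
  (∀ j → lookup G j ≈P lookup G' j) → compose p G ≈P compose p' G'
compose-cong {p = p} {p'} {G} {G'} p≈p' G≈G' = coeffwise λ γ → begin
  coeff (compose p G) γ                    ≡⟨ coeff-compose p G γ ⟩
  lin (λ α → coeff (monoAt G α) γ) p       ≡⟨ lin-ext (λ α → same-coeff (monoAt-cong G G' α G≈G') γ) p ⟩
  lin (λ α → coeff (monoAt G' α) γ) p      ≡⟨ lin-cong _ p≈p' ⟩
  lin (λ α → coeff (monoAt G' α) γ) p'     ≡⟨ coeff-compose p' G' γ ⟨
  coeff (compose p' G') γ                  ∎
  where open ≡-Reasoning

-- Composing the variable X_i with G gives G_i.  This identifies P_1 with H.

unitMono : ∀ {n} → Fin n → Mono n
unitMono i = tabulate (λ j → if does (i Fin.≟ j) then 1 else 0)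

*-one : ∀ {n} (p : Poly n) → (p *P constP 1ℤ) ≈P p
*-one p = coeffwise λ γ →
  trans (coeff-* p (constP 1ℤ) γ)
    (trans (lin-ext (λ α → cong (λ v → coeff ((1ℤ , v) ∷ []) γ) (zipWith-+-identityʳ α)) p)
      (lin-single p γ))
  where
  lin-single : ∀ {n} (p : Poly n) γ → lin (λ α → coeff ((1ℤ , α) ∷ []) γ) p ≡ coeff p γ
  lin-single [] γ = refl
  lin-single ((c , β) ∷ p) γ with does (monoEq β γ)
  ... | true = cong₂ _+ᶻ_ (ZP.*-identityʳ c) (lin-single p γ)
  ... | false = trans (cong (_+ᶻ _) (ZP.*-zeroʳ c)) (trans (ZP.+-identityˡ _) (lin-single p γ))

one-* : ∀ {n} (p : Poly n) → (constP 1ℤ *P p) ≈P p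
one-* p = coeffwise λ γ → trans (coeff-const* 1ℤ p γ) (ZP.*-identityˡ _)

monoAt-zero : ∀ {m n} (G : PolyMap m n) → monoAt G (tabulate (λ _ → 0)) ≈P constP 1ℤ
monoAt-zero Vec.[] = coeffwise λ γ → refl
monoAt-zero (g Vec.∷ G) = coeffwise λ γ →
  trans (same-coeff (one-* (monoAt G (tabulate (λ _ → 0)))) γ) (same-coeff (monoAt-zero G) γ)

monoAt-unit : ∀ {m n} (G : PolyMap m n) (i : Fin m) → monoAt G (unitMono i) ≈P lookup G i
monoAt-unit (g Vec.∷ G) Fin.zero = coeffwise λ γ →
  trans (same-coeff (*-cong (*-one g) (monoAt-zero G)) γ) (same-coeff (*-one g) γ)
monoAt-unit (g Vec.∷ G) (Fin.suc i) = coeffwise λ γ →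
  trans (same-coeff (one-* (monoAt G (unitMono i))) γ) (same-coeff (monoAt-unit G i) γ)

compose-var : ∀ {m n} (G : PolyMap m n) (i : Fin m) → compose (varP i) G ≈P lookup G i
compose-var G i = coeffwise λ γ →
  trans (coeff-compose (varP i) G γ)
    (trans (ZP.+-identityʳ _) (trans (ZP.*-identityˡ _) (same-coeff (monoAt-unit G i) γ)))

-- Supports and normal forms.

unique-length-≤ : ∀ {A : Set} {xs ys : List A} → Unique xs → (∀ {x} → x ∈ xs → x ∈ ys) →
  length xs ≤ length ys
unique-length-≤ {xs = []} _ _ = z≤n
unique-length-≤ {xs = x ∷ xs} {ys} (x∉xs AllPairs.∷ xs!) xs⊆ys with ∈-∃++ (xs⊆ys (here refl))
... | us , vs , refl =
  NP.≤-trans (s≤s (unique-length-≤ xs! xs⊆us++vs)) (NP.≤-reflexive (sym (length-++-sucʳ us x vs)))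
  where
  xs⊆us++vs : ∀ {z} → z ∈ xs → z ∈ us ++ vs
  xs⊆us++vs z∈xs with ∈-++⁻ us (xs⊆ys (there z∈xs))
  ... | inj₁ z∈us = ∈-++⁺ˡ z∈us
  ... | inj₂ (here refl) = ⊥-elim (All.lookup x∉xs z∈xs refl)
  ... | inj₂ (there z∈vs) = ∈-++⁺ʳ us z∈vs

∈⇒1≤length : ∀ {A : Set} {x : A} {xs} → x ∈ xs → 1 ≤ length xs
∈⇒1≤length (here _) = s≤s z≤n
∈⇒1≤length (there _) = s≤s z≤n

module _ {n : ℕ} where

  nonzero⇒listed : ∀ (p : Poly n) α → ¬ coeff p α ≡ 0ℤ → α ∈ List.map proj₂ p
  nonzero⇒listed [] α c≢0 = ⊥-elim (c≢0 refl)
  nonzero⇒listed ((c , β) ∷ p) α c≢0 with monoEq β α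
  ... | yes refl = here refl
  ... | no _ = there (nonzero⇒listed p α c≢0)

  support⇒nonzero : ∀ (p : Poly n) {α} → α ∈ support p → ¬ coeff p α ≡ 0ℤ
  support⇒nonzero p α∈p =
    proj₂ (∈-filter⁻ (λ α → ¬? (coeff p α ℤ.≟ 0ℤ)) {xs = List.deduplicate monoEq (List.map proj₂ p)} α∈p)

  nonzero⇒support : ∀ (p : Poly n) α → ¬ coeff p α ≡ 0ℤ → α ∈ support p
  nonzero⇒support p α c≢0 =
    ∈-filter⁺ (λ α → ¬? (coeff p α ℤ.≟ 0ℤ)) (∈-deduplicate⁺ monoEq (nonzero⇒listed p α c≢0)) c≢0

  support-unique : ∀ (p : Poly n) → Unique (support p)
  support-unique p =
    UniqueP.filter⁺ (λ α → ¬? (coeff p α ℤ.≟ 0ℤ)) (UniqueDecP.deduplicate-! monoEq (List.map proj₂ p))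

  len-≤-terms : ∀ {p q : Poly n} → p ≈P q → len p ≤ length q
  len-≤-terms {p} {q} p≈q =
    NP.≤-trans (unique-length-≤ (support-unique p) supp⊆q) (NP.≤-reflexive (length-map proj₂ q))
    where
    supp⊆q : ∀ {α} → α ∈ support p → α ∈ List.map proj₂ q
    supp⊆q {α} α∈p = nonzero⇒listed q α (λ c≡0 → support⇒nonzero p α∈p (trans (same-coeff p≈q α) c≡0))

  support-≈ : ∀ {p q : Poly n} → p ≈P q → ∀ {α} → α ∈ support p → α ∈ support q
  support-≈ {p} {q} p≈q {α} α∈p =
    nonzero⇒support q α (λ c≡0 → support⇒nonzero p α∈p (trans (same-coeff p≈q α) c≡0))

  termsOn : (Mono n → ℤ) → List (Mono n) → Poly n
  termsOn f = List.map (λ α → f α , α)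

  coeff-termsOn-∉ : ∀ f L γ → ¬ γ ∈ L → coeff (termsOn f L) γ ≡ 0ℤ
  coeff-termsOn-∉ f [] γ _ = refl
  coeff-termsOn-∉ f (α ∷ L) γ γ∉ with monoEq α γ
  ... | yes refl = ⊥-elim (γ∉ (here refl))
  ... | no _ = coeff-termsOn-∉ f L γ (λ γ∈L → γ∉ (there γ∈L))

  coeff-termsOn-∈ : ∀ f L γ → Unique L → γ ∈ L → coeff (termsOn f L) γ ≡ f γ
  coeff-termsOn-∈ f (α ∷ L) γ (α∉L AllPairs.∷ L!) γ∈ with monoEq α γ
  ... | yes refl =
    trans (cong (f α +ᶻ_) (coeff-termsOn-∉ f L γ (λ γ∈L → All.lookup α∉L γ∈L refl))) (ZP.+-identityʳ (f α))
  ... | no α≢γ with γ∈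
  ...   | here γ≡α = ⊥-elim (α≢γ (sym γ≡α))
  ...   | there γ∈L = coeff-termsOn-∈ f L γ L! γ∈L

  N : Poly n → Poly n
  N p = termsOn (coeff p) (support p)

  N-≈ : ∀ (p : Poly n) → N p ≈P p
  N-≈ p = coeffwise coeff-N
    where
    coeff-N : ∀ γ → coeff (N p) γ ≡ coeff p γ
    coeff-N γ with _∈?_ monoEq γ (support p)
    ... | yes γ∈ = coeff-termsOn-∈ (coeff p) (support p) γ (support-unique p) γ∈
    ... | no γ∉ with coeff p γ ℤ.≟ 0ℤ
    ...   | yes c≡0 = trans (coeff-termsOn-∉ (coeff p) (support p) γ γ∉) (sym c≡0)
    ...   | no c≢0 = ⊥-elim (γ∉ (nonzero⇒support p γ c≢0))

  length-N : ∀ (p : Poly n) → length (N p) ≡ len p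
  length-N p = length-map _ (support p)

-- Weighted masses.

record Weight : Set where
  field
    w : ℤ → ℕ
    w-* : ∀ a b → w (a *ᶻ b) ≡ w a * w b
    w-1 : w 1ℤ ≡ 1
    w-neg : ∀ a → w (-ᶻ a) ≡ w a

module _ (W : Weight) where
  open Weight W

  μ : ∀ {n} → Poly n → ℕ
  μ [] = 0
  μ ((c , β) ∷ p) = w c + μ p

  μ-++ : ∀ {n} (p q : Poly n) → μ (p ++ q) ≡ μ p + μ q
  μ-++ [] q = refl
  μ-++ ((c , β) ∷ p) q = trans (cong (w c +_) (μ-++ p q)) (sym (NP.+-assoc (w c) (μ p) (μ q)))

  μ-neg : ∀ {n} (p : Poly n) → μ (negP p) ≡ μ p
  μ-neg [] = refl
  μ-neg ((c , β) ∷ p) = cong₂ _+_ (w-neg c) (μ-neg p)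

  μ-sub : ∀ {n} (p q : Poly n) → μ (p -P q) ≡ μ p + μ q
  μ-sub p q = trans (μ-++ p (negP q)) (cong (μ p +_) (μ-neg q))

  μ-* : ∀ {n} (p q : Poly n) → μ (p *P q) ≡ μ p * μ q
  μ-* [] q = refl
  μ-* ((c , α) ∷ p) q =
    trans (μ-++ (List.map (λ s → c *ᶻ proj₁ s , Vec.zipWith _+_ α (proj₂ s)) q) (p *P q))
      (trans (cong₂ _+_ (μ-scaled q) (μ-* p q)) (sym (NP.*-distribʳ-+ (μ q) (w c) (μ p))))
    where
    μ-scaled : ∀ r → μ (List.map (λ s → c *ᶻ proj₁ s , Vec.zipWith _+_ α (proj₂ s)) r) ≡ w c * μ r
    μ-scaled [] = sym (NP.*-zeroʳ (w c))
    μ-scaled ((d , β) ∷ r) =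
      trans (cong₂ _+_ (w-* c d) (μ-scaled r)) (sym (NP.*-distribˡ-+ (w c) (w d) (μ r)))

  μ-one : ∀ {n} → μ (constP {n} 1ℤ) ≡ 1
  μ-one = cong (_+ 0) w-1

  μ-^ : ∀ {n} (p : Poly n) k → μ (p ^P k) ≡ μ p ^ k
  μ-^ {n} p zero = μ-one {n}
  μ-^ p (suc k) = trans (μ-* p (p ^P k)) (cong (μ p *_) (μ-^ p k))

  μ-monoAt : ∀ {m n} (G : PolyMap m n) α M → (∀ j → μ (lookup G j) ≤ M) → μ (monoAt G α) ≤ M ^ totalDeg α
  μ-monoAt {n = n} Vec.[] Vec.[] M _ = NP.≤-reflexive (μ-one {n})
  μ-monoAt (g Vec.∷ G) (a Vec.∷ α) M μG≤M = begin
    μ ((g ^P a) *P monoAt G α)             ≡⟨ μ-* (g ^P a) (monoAt G α) ⟩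
    μ (g ^P a) * μ (monoAt G α)            ≡⟨ cong (_* μ (monoAt G α)) (μ-^ g a) ⟩
    μ g ^ a * μ (monoAt G α)               ≤⟨ NP.*-mono-≤ (NP.^-monoˡ-≤ a (μG≤M Fin.zero))
                                                (μ-monoAt G α M (λ j → μG≤M (Fin.suc j))) ⟩
    M ^ a * M ^ totalDeg α                 ≡⟨ NP.^-distribˡ-+-* M a (totalDeg α) ⟨
    M ^ (a + totalDeg α)                   ∎
    where open NP.≤-Reasoning

DegBound : ∀ {n} → ℕ → Poly n → Set
DegBound E = All (λ t → totalDeg (proj₂ t) ≤ E)

totalDeg-zipWith : ∀ {n} (α β : Mono n) → totalDeg (Vec.zipWith _+_ α β) ≡ totalDeg α + totalDeg β
totalDeg-zipWith Vec.[] Vec.[] = refl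
totalDeg-zipWith (a Vec.∷ α) (b Vec.∷ β) =
  trans (cong (a + b +_) (totalDeg-zipWith α β)) (interchange a b (totalDeg α) (totalDeg β))
  where
  interchange : ∀ a b x y → a + b + (x + y) ≡ a + x + (b + y)
  interchange = ℕ-Solver.solve-∀

totalDeg-zero : ∀ n → totalDeg (Vec.replicate n 0) ≡ 0
totalDeg-zero zero = refl
totalDeg-zero (suc n) = totalDeg-zero n

DegBound-mono : ∀ {n a b} {p : Poly n} → a ≤ b → DegBound a p → DegBound b p
DegBound-mono a≤b = All.map (λ d≤a → NP.≤-trans d≤a a≤b)

DegBound-++ : ∀ {n E} {p q : Poly n} → DegBound E p → DegBound E q → DegBound E (p ++ q)
DegBound-++ [] dq = dq
DegBound-++ (d ∷ dp) dq = d ∷ DegBound-++ dp dq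

DegBound-neg : ∀ {n E} {p : Poly n} → DegBound E p → DegBound E (negP p)
DegBound-neg [] = []
DegBound-neg (d ∷ dp) = d ∷ DegBound-neg dp

DegBound-* : ∀ {n a b} {p q : Poly n} → DegBound a p → DegBound b q → DegBound (a + b) (p *P q)
DegBound-* [] dq = []
DegBound-* {a = a} {b} {(c , α) ∷ p} {q} (dα ∷ dp) dq = DegBound-++ (shifted q dq) (DegBound-* dp dq)
  where
  shifted : ∀ r → DegBound b r →
    DegBound (a + b) (List.map (λ s → c *ᶻ proj₁ s , Vec.zipWith _+_ α (proj₂ s)) r)
  shifted [] [] = []
  shifted ((d , β) ∷ r) (dβ ∷ dr) =
    NP.≤-trans (NP.≤-reflexive (totalDeg-zipWith α β)) (NP.+-mono-≤ dα dβ) ∷ shifted r dr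

DegBound-const : ∀ {n} c → DegBound 0 (constP {n} c)
DegBound-const {n} c = NP.≤-reflexive (totalDeg-zero n) ∷ []

DegBound-^ : ∀ {n d} {p : Poly n} → DegBound d p → ∀ k → DegBound (k * d) (p ^P k)
DegBound-^ dp zero = DegBound-const 1ℤ
DegBound-^ dp (suc k) = DegBound-* dp (DegBound-^ dp k)

DegBound-monoAt : ∀ {m n d} (G : PolyMap m n) α → (∀ j → DegBound d (lookup G j)) →
  DegBound (totalDeg α * d) (monoAt G α)
DegBound-monoAt Vec.[] Vec.[] dG = DegBound-const 1ℤ
DegBound-monoAt {d = d} (g Vec.∷ G) (a Vec.∷ α) dG =
  DegBound-mono (NP.≤-reflexive (sym (NP.*-distribʳ-+ d a (totalDeg α))))
    (DegBound-* (DegBound-^ (dG Fin.zero) a) (DegBound-monoAt G α (λ j → dG (Fin.suc j))))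

DegBound-compose : ∀ {m n E d} (p : Poly m) (G : PolyMap m n) → DegBound E p →
  (∀ j → DegBound d (lookup G j)) → DegBound (E * d) (compose p G)
DegBound-compose [] G _ _ = []
DegBound-compose {d = d} ((c , α) ∷ p) G (dα ∷ dp) dG =
  DegBound-++ (DegBound-mono (NP.*-monoˡ-≤ d dα) (DegBound-* (DegBound-const c) (DegBound-monoAt G α dG)))
              (DegBound-compose p G dp dG)

DegBound-nonzero : ∀ {n E} {q : Poly n} α → DegBound E q → ¬ coeff q α ≡ 0ℤ → totalDeg α ≤ E
DegBound-nonzero {q = []} α _ c≢0 = ⊥-elim (c≢0 refl)
DegBound-nonzero {q = (c , β) ∷ q} α (dβ ∷ dq) c≢0 with monoEq β α
... | yes refl = dβ
... | no _ = DegBound-nonzero α dq c≢0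

DegBound-N : ∀ {n E} (p : Poly n) → (∀ {α} → α ∈ support p → totalDeg α ≤ E) → DegBound E (N p)
DegBound-N p bound = AllP.map⁺ (All.tabulate bound)

μ-compose : ∀ W {m n} (p : Poly m) (G : PolyMap m n) E M → DegBound E p →
  (∀ j → μ W (lookup G j) ≤ M) → 1 ≤ M → μ W (compose p G) ≤ μ W p * M ^ E
μ-compose W [] G E M _ _ _ = z≤n
μ-compose W ((c , α) ∷ p) G E M (dα ∷ dp) μG≤M 1≤M = begin
  μ W ((constP c *P monoAt G α) ++ compose p G)           ≡⟨ μ-++ W (constP c *P monoAt G α) (compose p G) ⟩
  μ W (constP c *P monoAt G α) + μ W (compose p G)        ≡⟨ cong (_+ μ W (compose p G)) (μ-* W (constP c) (monoAt G α)) ⟩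
  (w c + 0) * μ W (monoAt G α) + μ W (compose p G)        ≤⟨ NP.+-mono-≤ (NP.*-mono-≤ (NP.≤-reflexive (NP.+-identityʳ (w c))) monoAt≤)
                                                              (μ-compose W p G E M dp μG≤M 1≤M) ⟩
  w c * M ^ E + μ W p * M ^ E                             ≡⟨ NP.*-distribʳ-+ (M ^ E) (w c) (μ W p) ⟨
  (w c + μ W p) * M ^ E                                   ∎
  where
  open Weight W
  open NP.≤-Reasoning
  monoAt≤ : μ W (monoAt G α) ≤ M ^ E
  monoAt≤ = NP.≤-trans (μ-monoAt W G α M μG≤M) (NP.^-monoʳ-≤ M {{ℕ.>-nonZero 1≤M}} dα)

absWeight : Weight
absWeight = record { w = ∣_∣ ; w-* = ZP.∣i*j∣≡∣i∣*∣j∣ ; w-1 = refl ; w-neg = ZP.∣-i∣≡∣i∣ }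

countWeight : Weight
countWeight = record { w = λ _ → 1 ; w-* = λ _ _ → refl ; w-1 = refl ; w-neg = λ _ → refl }

μ-count : ∀ {n} (p : Poly n) → μ countWeight p ≡ length p
μ-count [] = refl
μ-count (t ∷ p) = cong suc (μ-count p)

coeff≤mass : ∀ {n} (p : Poly n) γ → ∣ coeff p γ ∣ ≤ μ absWeight p
coeff≤mass [] γ = z≤n
coeff≤mass ((c , β) ∷ p) γ with does (monoEq β γ)
... | true = NP.≤-trans (ZP.∣i+j∣≤∣i∣+∣j∣ c (coeff p γ)) (NP.+-monoʳ-≤ ∣ c ∣ (coeff≤mass p γ))
... | false = NP.≤-trans (coeff≤mass p γ) (NP.m≤n+m (μ absWeight p) ∣ c ∣)

maxℕ-upper : ∀ {n} {A : Set} (f : A → ℕ) {L : List A} {x} → x ∈ L → f x ≤ maxℕ {n} (List.map f L)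
maxℕ-upper f {y ∷ L} (here refl) = NP.m≤m⊔n (f y) _
maxℕ-upper {n} f {y ∷ L} (there x∈L) = NP.≤-trans (maxℕ-upper {n} f x∈L) (NP.m≤n⊔m (f y) _)

maxℕ-least : ∀ {n} {A : Set} (f : A → ℕ) (L : List A) X → (∀ {x} → x ∈ L → f x ≤ X) →
  maxℕ {n} (List.map f L) ≤ X
maxℕ-least f [] X _ = z≤n
maxℕ-least {n} f (y ∷ L) X bound = NP.⊔-lub (bound (here refl)) (maxℕ-least {n} f L X (λ x∈L → bound (there x∈L)))

vecMax : ∀ {A : Set} {m} → (A → ℕ) → Vec A m → ℕ
vecMax f v = Vec.foldr _ _⊔_ 0 (Vec.map f v)

vecMax-upper : ∀ {A : Set} {m} (f : A → ℕ) (v : Vec A m) i → f (lookup v i) ≤ vecMax f v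
vecMax-upper f (x Vec.∷ v) Fin.zero = NP.m≤m⊔n (f x) _
vecMax-upper f (x Vec.∷ v) (Fin.suc i) = NP.≤-trans (vecMax-upper f v i) (NP.m≤n⊔m (f x) _)

vecMax-least : ∀ {A : Set} {m} (f : A → ℕ) (v : Vec A m) X → (∀ i → f (lookup v i) ≤ X) → vecMax f v ≤ X
vecMax-least f Vec.[] X _ = z≤n
vecMax-least f (x Vec.∷ v) X bound = NP.⊔-lub (bound Fin.zero) (vecMax-least f v X (λ i → bound (Fin.suc i)))

μ-N : ∀ {n} (p : Poly n) → μ absWeight (N p) ≤ len p * maxCoeff p
μ-N {n} p = onList (support p)
  where
  C : List (Mono n) → ℕ
  C L = maxℕ {n} (List.map (λ α → ∣ coeff p α ∣) L)
  onList : ∀ L → μ absWeight (termsOn (coeff p) L) ≤ length L * C L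
  onList [] = z≤n
  onList (α ∷ L) = NP.+-mono-≤ (NP.m≤m⊔n ∣ coeff p α ∣ (C L))
    (NP.≤-trans (onList L) (NP.*-monoʳ-≤ (length L) (NP.m≤n⊔m ∣ coeff p α ∣ (C L))))

prodFromTo-step : ∀ k f → prodFromTo 1 (suc k) f ≡ prodFromTo 1 k f * f (suc k)
prodFromTo-step k f = begin
  product (List.map f (List.map (1 +_) (List.upTo (suc k))))
    ≡⟨ cong (λ js → product (List.map f (List.map (1 +_) js))) (upTo-∷ʳ k) ⟨
  product (List.map f (List.map (1 +_) (List.upTo k ++ k ∷ [])))
    ≡⟨ cong product (trans (cong (List.map f) (map-++ (1 +_) (List.upTo k) (k ∷ [])))
                           (map-++ f (List.map (1 +_) (List.upTo k)) (suc k ∷ []))) ⟩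
  product (List.map f (List.map (1 +_) (List.upTo k)) ++ f (suc k) ∷ [])
    ≡⟨ product-++ (List.map f (List.map (1 +_) (List.upTo k))) (f (suc k) ∷ []) ⟩
  prodFromTo 1 k f * (f (suc k) * 1)
    ≡⟨ cong (prodFromTo 1 k f *_) (NP.*-identityʳ (f (suc k))) ⟩
  prodFromTo 1 k f * f (suc k)
    ∎
  where open ≡-Reasoning

lseq-step : ∀ l D k → 1 ≤ k → lseq l D (suc k) ≡ lseq l D k * (l ^ (D ^ k) + 1)
lseq-step l D (suc k) _ =
  trans (cong ((l ∸ 1) *_) (prodFromTo-step k (λ j → l ^ (D ^ j) + 1)))
        (sym (NP.*-assoc (l ∸ 1) _ (l ^ (D ^ suc k) + 1)))

^-distribʳ-* : ∀ a b E → (a * b) ^ E ≡ a ^ E * b ^ E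
^-distribʳ-* a b zero = refl
^-distribʳ-* a b (suc E) = trans (cong (a * b *_) (^-distribʳ-* a b E)) (interchange a b (a ^ E) (b ^ E))
  where
  interchange : ∀ a b x y → a * b * (x * y) ≡ a * x * (b * y)
  interchange = ℕ-Solver.solve-∀

final-estimate : ∀ lk Bk l B E → 1 ≤ B →
  lk * Bk * (l * B) ^ E + lk * Bk ≤ Bk * B ^ E * (lk * (l ^ E + 1))
final-estimate lk Bk l B E 1≤B = begin
  lk * Bk * (l * B) ^ E + lk * Bk              ≡⟨ cong (λ z → lk * Bk * z + lk * Bk) (^-distribʳ-* l B E) ⟩
  lk * Bk * (l ^ E * B ^ E) + lk * Bk          ≤⟨ NP.+-monoʳ-≤ (lk * Bk * (l ^ E * B ^ E)) (NP.m≤m*n (lk * Bk) (B ^ E)) ⟩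
  lk * Bk * (l ^ E * B ^ E) + lk * Bk * B ^ E  ≡⟨ regroup lk Bk (l ^ E) (B ^ E) ⟩
  Bk * B ^ E * (lk * (l ^ E + 1))              ∎
  where
  open NP.≤-Reasoning
  instance
    B^E≢0 : ℕ.NonZero (B ^ E)
    B^E≢0 = NP.m^n≢0 B E {{ℕ.>-nonZero 1≤B}}
  regroup : ∀ lk Bk x y → lk * Bk * (x * y) + lk * Bk * y ≡ Bk * y * (lk * (x + 1))
  regroup = ℕ-Solver.solve-∀

^-step-≤ : ∀ D k → 1 ≤ k → D ^ k ≤ D ^ suc k
^-step-≤ zero (suc k) _ = z≤n
^-step-≤ (suc D) k _ = NP.m≤n*m (suc D ^ k) (suc D)

^-step-⊔ : ∀ D k → 1 ≤ k → D ^ k * (1 ⊔ D) ≤ D ^ suc k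
^-step-⊔ zero (suc k) _ = z≤n
^-step-⊔ (suc D) k _ = NP.≤-reflexive (NP.*-comm (suc D ^ k) (suc D))

totalDeg-unit : ∀ {n} (i : Fin n) → totalDeg (unitMono i) ≡ 1
totalDeg-unit {suc n} Fin.zero = cong suc (allZero n)
  where
  allZero : ∀ n → Vec.sum (tabulate {n = n} (λ _ → 0)) ≡ 0
  allZero zero = refl
  allZero (suc n) = allZero n
totalDeg-unit {suc n} (Fin.suc i) = totalDeg-unit i

coeff-var-unit : ∀ {n} (i : Fin n) → coeff (varP i) (unitMono i) ≡ 1ℤ
coeff-var-unit i with monoEq (unitMono i) (unitMono i)
... | yes _ = refl
... | no ≢ = ⊥-elim (≢ refl)

coeff-var-other : ∀ {n} (i : Fin n) γ → ¬ unitMono i ≡ γ → coeff (varP i) γ ≡ 0ℤ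
coeff-var-other i γ ≢γ with monoEq (unitMono i) γ
... | yes ≡γ = ⊥-elim (≢γ ≡γ)
... | no _ = refl

module Iteration (n : ℕ) (H : PolyMap n n) (H≥2 : ∀ (i : Fin n) → LowerDeg≥ 2 (lookup H i)) where

  F : PolyMap n n
  F = plusX H

  D l B : ℕ
  D = degMap H
  l = lenMap F
  B = maxCoeffMap F

  P : ℕ → Fin n → Poly n
  P k i = lookup (Pseq F k) i

  coeff-F : ∀ i γ → coeff (lookup F i) γ ≡ coeff (varP i) γ +ᶻ coeff (lookup H i) γ
  coeff-F i γ =
    trans (cong (λ p → coeff p γ)
                (trans (lookup-zipWith _+P_ i (idMap n) H) (cong (_++ lookup H i) (lookup∘tabulate varP i))))
          (coeff-++ (varP i) (lookup H i) γ)

  -- Since H_i has lower degree ≥ 2, it does not contain the monomial X_i.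
  unit∉H : ∀ i → ¬ unitMono i ∈ support (lookup H i)
  unit∉H i X_i∈H with NP.≤-trans (All.lookup (H≥2 i) X_i∈H) (NP.≤-reflexive (totalDeg-unit i))
  ... | s≤s ()

  coeff-H-unit : ∀ i → coeff (lookup H i) (unitMono i) ≡ 0ℤ
  coeff-H-unit i with coeff (lookup H i) (unitMono i) ℤ.≟ 0ℤ
  ... | yes c≡0 = c≡0
  ... | no c≢0 = ⊥-elim (unit∉H i (nonzero⇒support (lookup H i) (unitMono i) c≢0))

  coeff-F-unit : ∀ i → coeff (lookup F i) (unitMono i) ≡ 1ℤ
  coeff-F-unit i = trans (coeff-F i (unitMono i)) (cong₂ _+ᶻ_ (coeff-var-unit i) (coeff-H-unit i))

  unit∈F : ∀ i → unitMono i ∈ support (lookup F i)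
  unit∈F i = nonzero⇒support (lookup F i) (unitMono i) (λ c≡0 → one≢0 (trans (sym (coeff-F-unit i)) c≡0))
    where
    one≢0 : ¬ 1ℤ ≡ 0ℤ
    one≢0 ()

  coeff-F-other : ∀ i γ → ¬ unitMono i ≡ γ → coeff (lookup F i) γ ≡ coeff (lookup H i) γ
  coeff-F-other i γ ≢γ =
    trans (coeff-F i γ) (trans (cong (_+ᶻ coeff (lookup H i) γ) (coeff-var-other i γ ≢γ)) (ZP.+-identityˡ _))

  deg-H : ∀ i {α} → α ∈ support (lookup H i) → totalDeg α ≤ D
  deg-H i α∈H = NP.≤-trans (maxℕ-upper {n} totalDeg α∈H) (vecMax-upper deg H i)

  deg-F : ∀ i {α} → α ∈ support (lookup F i) → totalDeg α ≤ 1 ⊔ D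
  deg-F i {α} α∈F with monoEq (unitMono i) α
  ... | yes refl = NP.≤-trans (NP.≤-reflexive (totalDeg-unit i)) (NP.m≤m⊔n 1 D)
  ... | no ≢α = NP.≤-trans (deg-H i (nonzero⇒support (lookup H i) α c≢0)) (NP.m≤n⊔m 1 D)
    where
    c≢0 : ¬ coeff (lookup H i) α ≡ 0ℤ
    c≢0 c≡0 = support⇒nonzero (lookup F i) α∈F (trans (coeff-F-other i α ≢α) c≡0)

  -- The support of F_i is that of H_i plus X_i, so l(H_i) + 1 ≤ l(F_i).
  len-H<len-F : ∀ i → suc (len (lookup H i)) ≤ len (lookup F i)
  len-H<len-F i =
    unique-length-≤ {xs = unitMono i ∷ support (lookup H i)}
      (All.tabulate X_i≢ AllPairs.∷ support-unique (lookup H i)) ⊆F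
    where
    X_i≢ : ∀ {α} → α ∈ support (lookup H i) → ¬ unitMono i ≡ α
    X_i≢ α∈H refl = unit∉H i α∈H
    ⊆F : ∀ {α} → α ∈ unitMono i ∷ support (lookup H i) → α ∈ support (lookup F i)
    ⊆F (here refl) = unit∈F i
    ⊆F {α} (there α∈H) = nonzero⇒support (lookup F i) α
      (λ c≡0 → support⇒nonzero (lookup H i) α∈H (trans (sym (coeff-F-other i α (X_i≢ α∈H))) c≡0))

  len-F≤l : ∀ i → len (lookup F i) ≤ l
  len-F≤l = vecMax-upper len F

  maxCoeff-F≤B : ∀ i → maxCoeff (lookup F i) ≤ B
  maxCoeff-F≤B = vecMax-upper maxCoeff F

  -- With at least one variable, l ≥ 1 and B ≥ 1 (witnessed by the term X_i of F_i).
  1≤l : Fin n → 1 ≤ l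
  1≤l i = NP.≤-trans (∈⇒1≤length (unit∈F i)) (len-F≤l i)

  1≤B : Fin n → 1 ≤ B
  1≤B i = NP.≤-trans (NP.≤-reflexive (sym (cong ∣_∣ (coeff-F-unit i))))
            (NP.≤-trans (maxℕ-upper {n} (λ α → ∣ coeff (lookup F i) α ∣) (unit∈F i)) (maxCoeff-F≤B i))

  NF : PolyMap n n
  NF = Vec.map N F

  Q : ℕ → Fin n → Poly n
  Q k i = compose (N (P k i)) NF -P N (P k i)

  P-step : ∀ k i → P (suc k) i ≡ compose (P k i) F -P P k i
  P-step k i = trans (lookup-zipWith _-P_ i (composeMap (Pseq F k) F) (Pseq F k))
                     (cong (_-P P k i) (lookup-map i (λ p → compose p F) (Pseq F k)))

  P≈Q : ∀ k i → P (suc k) i ≈P Q k i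
  P≈Q k i = coeffwise λ γ →
    trans (cong (λ p → coeff p γ) (P-step k i))
          (same-coeff (sub-cong (compose-cong (≈-sym (N-≈ (P k i))) F≈NF) (≈-sym (N-≈ (P k i)))) γ)
    where
    F≈NF : ∀ j → lookup F j ≈P lookup NF j
    F≈NF j = subst (lookup F j ≈P_) (sym (lookup-map j N F)) (≈-sym (N-≈ (lookup F j)))

  P₁≈H : ∀ i → P 1 i ≈P lookup H i
  P₁≈H i = coeffwise λ γ → begin
    coeff (P 1 i) γ                                          ≡⟨ cong (λ p → coeff p γ) (P-step 0 i) ⟩
    coeff (compose (P 0 i) F -P P 0 i) γ                     ≡⟨ cong (λ p → coeff (compose p F -P p) γ) (lookup∘tabulate varP i) ⟩
    coeff (compose (varP i) F -P varP i) γ                   ≡⟨ coeff-sub (compose (varP i) F) (varP i) γ ⟩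
    coeff (compose (varP i) F) γ +ᶻ -ᶻ coeff (varP i) γ      ≡⟨ cong (_+ᶻ -ᶻ coeff (varP i) γ) (same-coeff (compose-var F i) γ) ⟩
    coeff (lookup F i) γ +ᶻ -ᶻ coeff (varP i) γ              ≡⟨ cong (_+ᶻ -ᶻ coeff (varP i) γ) (coeff-F i γ) ⟩
    coeff (varP i) γ +ᶻ coeff (lookup H i) γ +ᶻ -ᶻ coeff (varP i) γ   ≡⟨ cancel (coeff (varP i) γ) (coeff (lookup H i) γ) ⟩
    coeff (lookup H i) γ                                     ∎
    where
    open ≡-Reasoning
    cancel : ∀ a b → a +ᶻ b +ᶻ -ᶻ a ≡ b
    cancel = ℤ-Solver.solve-∀

  NF-lookup : ∀ j → lookup NF j ≡ N (lookup F j)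
  NF-lookup j = lookup-map j N F

  deg-NF : ∀ j → DegBound (1 ⊔ D) (lookup NF j)
  deg-NF j = subst (DegBound (1 ⊔ D)) (sym (NF-lookup j)) (DegBound-N (lookup F j) (deg-F j))

  count-NF : ∀ j → μ countWeight (lookup NF j) ≤ l
  count-NF j = NP.≤-trans
    (NP.≤-reflexive (trans (μ-count (lookup NF j)) (trans (cong length (NF-lookup j)) (length-N (lookup F j)))))
    (len-F≤l j)

  mass-NF : ∀ j → μ absWeight (lookup NF j) ≤ l * B
  mass-NF j = NP.≤-trans (NP.≤-reflexive (cong (μ absWeight) (NF-lookup j)))
    (NP.≤-trans (μ-N (lookup F j)) (NP.*-mono-≤ (len-F≤l j) (maxCoeff-F≤B j)))

  μ-Q : ∀ W k i M → 1 ≤ M → (∀ j → μ W (lookup NF j) ≤ M) → DegBound (D ^ k) (N (P k i)) →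
    μ W (Q k i) ≤ μ W (N (P k i)) * M ^ (D ^ k) + μ W (N (P k i))
  μ-Q W k i M 1≤M μNF≤M deg-NP = begin
    μ W (Q k i)                                         ≡⟨ μ-sub W (compose (N (P k i)) NF) (N (P k i)) ⟩
    μ W (compose (N (P k i)) NF) + μ W (N (P k i))      ≤⟨ NP.+-monoˡ-≤ (μ W (N (P k i)))
                                                            (μ-compose W (N (P k i)) NF (D ^ k) M deg-NP μNF≤M 1≤M) ⟩
    μ W (N (P k i)) * M ^ (D ^ k) + μ W (N (P k i))     ∎
    where open NP.≤-Reasoning

  deg-Q : ∀ k → 1 ≤ k → ∀ i → (∀ {α} → α ∈ support (P k i) → totalDeg α ≤ D ^ k) → DegBound (D ^ suc k) (Q k i)
  deg-Q k 1≤k i deg-Pk =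
    DegBound-++ (DegBound-mono (^-step-⊔ D k 1≤k) (DegBound-compose (N (P k i)) NF deg-NP deg-NF))
                (DegBound-neg (DegBound-mono (^-step-≤ D k 1≤k) deg-NP))
    where
    deg-NP : DegBound (D ^ k) (N (P k i))
    deg-NP = DegBound-N (P k i) deg-Pk

  deg-P : ∀ k → 1 ≤ k → ∀ i {α} → α ∈ support (P k i) → totalDeg α ≤ D ^ k
  deg-P (suc zero) _ i α∈P₁ = NP.≤-trans (deg-H i (support-≈ (P₁≈H i) α∈P₁)) (NP.≤-reflexive (sym (NP.*-identityʳ D)))
  deg-P (suc (suc k)) _ i {α} α∈P = DegBound-nonzero α (deg-Q (suc k) (s≤s z≤n) i (deg-P (suc k) (s≤s z≤n) i))
    (support⇒nonzero (Q (suc k) i) (support-≈ (P≈Q (suc k) i) α∈P))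

  len-P₁ : ∀ i → len (P 1 i) ≤ lseq l D 1
  len-P₁ i = begin
    len (P 1 i)              ≤⟨ len-≤-terms (≈-trans (P₁≈H i) (≈-sym (N-≈ (lookup H i)))) ⟩
    length (N (lookup H i))  ≡⟨ length-N (lookup H i) ⟩
    len (lookup H i)         ≤⟨ NP.∸-monoˡ-≤ 1 (NP.≤-trans (len-H<len-F i) (len-F≤l i)) ⟩
    l ∸ 1                    ≡⟨ NP.*-identityʳ (l ∸ 1) ⟨
    lseq l D 1               ∎
    where open NP.≤-Reasoning

  len-P-step : ∀ k → 1 ≤ k → ∀ i → (∀ {α} → α ∈ support (P k i) → totalDeg α ≤ D ^ k) →
    len (P k i) ≤ lseq l D k → len (P (suc k) i) ≤ lseq l D (suc k)
  len-P-step k 1≤k i deg-Pk len-Pk = begin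
    len (P (suc k) i)                 ≤⟨ len-≤-terms (P≈Q k i) ⟩
    length (Q k i)                    ≡⟨ μ-count (Q k i) ⟨
    μ countWeight (Q k i)             ≤⟨ μ-Q countWeight k i l (1≤l i) count-NF (DegBound-N (P k i) deg-Pk) ⟩
    c * l ^ E + c                     ≤⟨ NP.+-mono-≤ (NP.*-monoˡ-≤ (l ^ E) c≤lk) c≤lk ⟩
    lk * l ^ E + lk                   ≡⟨ factor lk (l ^ E) ⟩
    lk * (l ^ E + 1)                  ≡⟨ lseq-step l D k 1≤k ⟨
    lseq l D (suc k)                  ∎
    where
    open NP.≤-Reasoning
    E lk c : ℕ
    E = D ^ k
    lk = lseq l D k
    c = μ countWeight (N (P k i))
    c≤lk : c ≤ lk
    c≤lk = NP.≤-trans (NP.≤-reflexive (trans (μ-count (N (P k i))) (length-N (P k i)))) len-Pk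
    factor : ∀ a x → a * x + a ≡ a * (x + 1)
    factor = ℕ-Solver.solve-∀

  len-P : ∀ k → 1 ≤ k → ∀ i → len (P k i) ≤ lseq l D k
  len-P (suc zero) _ i = len-P₁ i
  len-P (suc (suc k)) _ i = len-P-step (suc k) (s≤s z≤n) i (deg-P (suc k) (s≤s z≤n) i) (len-P (suc k) (s≤s z≤n) i)

  coeff-P-bound : ∀ k → 1 ≤ k → ∀ i γ →
    ∣ coeff (P (suc k) i) γ ∣ ≤ maxCoeffMap (Pseq F k) * B ^ (D ^ k) * lseq l D (suc k)
  coeff-P-bound k 1≤k i γ = begin
    ∣ coeff (P (suc k) i) γ ∣               ≡⟨ cong ∣_∣ (same-coeff (P≈Q k i) γ) ⟩
    ∣ coeff (Q k i) γ ∣                     ≤⟨ coeff≤mass (Q k i) γ ⟩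
    μ absWeight (Q k i)                     ≤⟨ μ-Q absWeight k i (l * B) (NP.*-mono-≤ (1≤l i) (1≤B i)) mass-NF
                                                  (DegBound-N (P k i) (deg-P k 1≤k i)) ⟩
    m * (l * B) ^ E + m                     ≤⟨ NP.+-mono-≤ (NP.*-monoˡ-≤ ((l * B) ^ E) m≤lkBk) m≤lkBk ⟩
    lk * Bk * (l * B) ^ E + lk * Bk         ≤⟨ final-estimate lk Bk l B E (1≤B i) ⟩
    Bk * B ^ E * (lk * (l ^ E + 1))         ≡⟨ cong (Bk * B ^ E *_) (lseq-step l D k 1≤k) ⟨
    Bk * B ^ E * lseq l D (suc k)           ∎
    where
    open NP.≤-Reasoning
    E lk Bk m : ℕ
    E = D ^ k
    lk = lseq l D k
    Bk = maxCoeffMap (Pseq F k)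
    m = μ absWeight (N (P k i))
    m≤lkBk : m ≤ lk * Bk
    m≤lkBk = NP.≤-trans (μ-N (P k i)) (NP.*-mono-≤ (len-P k 1≤k i) (vecMax-upper maxCoeff (Pseq F k) i))

  B-step : ∀ k → 1 ≤ k →
    maxCoeffMap (Pseq F (suc k)) ≤ maxCoeffMap (Pseq F k) * B ^ (D ^ k) * lseq l D (suc k)
  B-step k 1≤k = vecMax-least maxCoeff (Pseq F (suc k)) _ λ i →
    maxℕ-least {n} (λ α → ∣ coeff (P (suc k) i) α ∣) (support (P (suc k) i)) _ λ {γ} _ → coeff-P-bound k 1≤k i γ

lemma4p2 : (n : ℕ) (H : PolyMap n n) →
    (∀ (i : Fin n) → LowerDeg≥ 2 (lookup H i)) →
    ∀ (k : ℕ) → 1 ≤ k →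
      maxCoeffMap (Pseq (plusX H) (suc k))
        ≤ maxCoeffMap (Pseq (plusX H) k) * maxCoeffMap (plusX H) ^ (degMap H ^ k)
          * lseq (lenMap (plusX H)) (degMap H) (suc k)
lemma4p2 n H H≥2 k 1≤k = Iteration.B-step n H H≥2 k 1≤k
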